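{- Let $a,b,c$ be distinct even positive integers with $ab+1=r^2$, $ac+1=s^2$, $bc+1=t^2$ for positive integers $r,s,t$ (necessarily odd), and suppose the triple is irregular, i.e. $a^2+b^2+c^2-2ab-2ac-2bc-4\neq 0$. Writing $(x,y)$ for $\gcd(x,y)$, define $a_{+O}=(a/2,(r+1)/2)$, $a_{ -O}=(a/2,(r-1)/2)$, $a_{O+}=(a/2,(s+1)/2)$, $a_{O- }=(a/2,(s-1)/2)$; $b_{+O}=(b/2,(r+1)/2)$, $b_{ -O}=(b/2,(r-1)/2)$, $b_{O+}=(b/2,(t+1)/2)$, $b_{O- }=(b/2,(t-1)/2)$; $c_{+O}=(c/2,(s+1)/2)$, $c_{ -O}=(c/2,(s-1)/2)$, $c_{O+}=(c/2,(t+1)/2)$, $c_{O- }=(c/2,(t-1)/2)$; and for $x\in\{a,b,c\}$ and $\epsilon,\delta\in\{+,-\}$ set $x_{\epsilon\delta}=(x_{\epsilon O},x_{O\delta})$. Then: (i) $a=2a_{++}a_{ -+}a_{+- }a_{ -- }$, $b=2b_{++}b_{ -+}b_{+- }b_{ -- }$, $c=2c_{++}c_{ -+}c_{+- }c_{ -- }$; (ii) $a_{++}a_{+- }b_{++}b_{+- }-a_{ -+}a_{ -- }b_{ -+}b_{ -- }=1$, $a_{++}a_{ -+}c_{++}c_{+- }-a_{+- }a_{ -- }c_{ -+}c_{ -- }=1$, $b_{++}b_{ -+}c_{++}c_{ -+}-b_{+- }b_{ -- }c_{+- }c_{ -- }=1$; (iii) with $d=a+b+c+2abc+2rst$ and $d_1=a_{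 -+}b_{ -- }c_{+- }+a_{+- }b_{++}c_{ -+}$, $d_2=a_{ -- }b_{ -+}c_{ -+}+a_{++}b_{+- }c_{+- }$, $d_3=a_{++}b_{++}c_{++}+a_{ -- }b_{ -- }c_{ -- }$, $d_4=a_{+- }b_{+- }c_{ -- }+a_{ -+}b_{ -+}c_{++}$, one has $d=2d_1d_2d_3d_4$; (iv) $c_{ -+}c_{+- }d_3d_4-c_{ -- }c_{++}d_1d_2=1$, $a_{+- }a_{ -+}d_2d_3-a_{++}a_{ -- }d_1d_4=1$, and $b_{ -+}b_{+- }d_1d_3-b_{ -- }b_{++}d_2d_4=1$.
   Context: A Diophantine triple is a set of distinct positive integers such that the product of any two is one less than a square. The number $d=a+b+c+2abc+2rst$ is the AHS extension of the triple, for which $\{a,b,c,d\}$ is a (regular) Diophantine quadruple. -}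

module Defs where

open import Data.Nat using (ℕ; _+_; _*_; _/_; _∸_)
open import Data.Nat.GCD using (gcd)
open import Data.Integer as ℤ using (ℤ; +_)

-- For odd u ≥ 1 the floor divisions below are exact.
xPO : ℕ → ℕ → ℕ
xPO x u = gcd (x / 2) ((u + 1) / 2)

xMO : ℕ → ℕ → ℕ
xMO x u = gcd (x / 2) ((u ∸ 1) / 2)

xPP xMP xPM xMM : ℕ → ℕ → ℕ → ℕ
xPP x u v = gcd (xPO x u) (xPO x v)
xMP x u v = gcd (xMO x u) (xPO x v)
xPM x u v = gcd (xPO x u) (xMO x v)
xMM x u v = gcd (xMO x u) (xMO x v)

irregQ : ℕ → ℕ → ℕ → ℤ
irregQ a b c =
  (A ℤ.* A ℤ.+ B ℤ.* B ℤ.+ C ℤ.* C)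
    ℤ.- (+ 2 ℤ.* A ℤ.* B ℤ.+ + 2 ℤ.* A ℤ.* C ℤ.+ + 2 ℤ.* B ℤ.* C ℤ.+ + 4)
  where
  A = + a
  B = + b
  C = + c

-- Since u is odd in xy + 1 = u² with x, y even, (x/2)(y/2) = ((u-1)/2)((u+1)/2), and the two
-- factors on the right are consecutive, hence coprime. So x/2 splits into its parts
-- gcd(x/2,(u±1)/2), and the (u+1)/2-parts of x/2 and y/2 multiply to (u+1)/2, the (u-1)/2-parts
-- to (u-1)/2. Splitting a/2 along both of its roots r and s and applying the four-number theorem
-- refines it into the four gcds a_{εδ}; this gives (i), (ii), and r, s, t as sums of two
-- products of gcds. Parts (iii) and (iv) are then polynomial identities in the twelve gcds modulo
-- the three unit relations of (ii).
module Submission where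

open import Defs
open import Data.Nat using (ℕ; _+_; _*_; NonZero)
open import Data.Nat.Divisibility using (_∣_)
open import Data.Integer using (ℤ; +_)
open import Data.Product using (_×_)
open import Relation.Binary.PropositionalEquality using (_≡_)
open import Relation.Nullary using (¬_)

open import Data.Nat using (suc; _∸_; _/_)
open import Data.Nat.Properties
open import Data.Nat.Divisibility
  using (divides; ∣-antisym; ∣-trans; ∣-refl; *-monoʳ-∣; m∣m*n; n∣m*n; ∣m⇒∣m*n; ∣m+n∣m⇒∣n; ∣1⇒≡1)
open import Data.Nat.GCD using (gcd; gcd[m,n]∣m; gcd[m,n]∣n; gcd-greatest; gcd-comm; c*gcd[m,n]≡gcd[cm,cn])
open import Data.Nat.Coprimality using (Coprime; coprime-divisor; coprime-+; 1-coprimeTo)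
import Data.Nat.Coprimality as Coprimality
open import Data.Nat.DivMod using (m*n/n≡m; _divMod_; result)
open import Data.Nat.Tactic.RingSolver using (solve-∀; solve)
open import Data.Fin using (zero; suc)
open import Data.List using (List; _∷_; [])
open import Data.Product using (∃-syntax; _,_)
open import Relation.Nullary using (contradiction)
open import Relation.Binary.PropositionalEquality
  using (refl; sym; trans; cong; cong₂; subst; module ≡-Reasoning)

private
  variable
    m n p q x y u : ℕ

coprime-∣-∣ : Coprime p q → m ∣ p → n ∣ q → Coprime m n
coprime-∣-∣ p⊥q m∣p n∣q (d∣m , d∣n) = p⊥q (∣-trans d∣m m∣p , ∣-trans d∣n n∣q)

coprime-+1 : ∀ n → Coprime (n + 1) n
coprime-+1 n = coprime-+ (1-coprimeTo n)

∣*⇒≡gcd*gcd : Coprime p q → m ∣ p * q → m ≡ gcd m p * gcd m q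
∣*⇒≡gcd*gcd {p} {q} {m} p⊥q m∣pq = ∣-antisym m∣gh gh∣m
  where
  g h : ℕ
  g = gcd m p
  h = gcd m q
  gh∣m : g * h ∣ m
  gh∣m with gcd[m,n]∣m m p
  ... | divides k m≡kg = subst (g * h ∣_) (trans (*-comm g k) (sym m≡kg)) (*-monoʳ-∣ g h∣k)
    where
    h∣k : h ∣ k
    h∣k = coprime-divisor (coprime-∣-∣ (Coprimality.sym p⊥q) (gcd[m,n]∣n m q) (gcd[m,n]∣n m p))
            (subst (h ∣_) (trans m≡kg (*-comm k g)) (gcd[m,n]∣m m q))
  m∣gq : m ∣ g * q
  m∣gq = subst (m ∣_) (trans (sym (c*gcd[m,n]≡gcd[cm,cn] q m p)) (*-comm q g))
           (gcd-greatest (n∣m*n q) (subst (m ∣_) (*-comm p q) m∣pq))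
  m∣gh : m ∣ g * h
  m∣gh = subst (m ∣_) (sym (c*gcd[m,n]≡gcd[cm,cn] g m q)) (gcd-greatest (n∣m*n g) m∣gq)

∣-antisym-* : ∀ {a a′ b b′} .{{_ : NonZero b}} → a ∣ a′ → b ∣ b′ → a′ * b′ ≡ a * b → a ≡ a′
∣-antisym-* {a} {a′} {b} {b′} a∣a′ (divides l b′≡lb) a′b′≡ab = ∣-antisym a∣a′ (divides l a≡la′)
  where
  open ≡-Reasoning
  a≡la′ : a ≡ l * a′
  a≡la′ = *-cancelʳ-≡ a (l * a′) b (begin
    a * b          ≡⟨ sym a′b′≡ab ⟩
    a′ * b′        ≡⟨ cong (a′ *_) b′≡lb ⟩
    a′ * (l * b)   ≡⟨ sym (*-assoc a′ l b) ⟩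
    a′ * l * b     ≡⟨ cong (_* b) (*-comm a′ l) ⟩
    l * a′ * b     ∎)

*≡gcd*gcd : Coprime p q → x * y ≡ p * q → x * y ≡ gcd x p * gcd y p * (gcd x q * gcd y q)
*≡gcd*gcd {p} {q} {x} {y} p⊥q xy≡pq = trans
  (cong₂ _*_ (∣*⇒≡gcd*gcd p⊥q (subst (x ∣_) xy≡pq (m∣m*n y)))
             (∣*⇒≡gcd*gcd p⊥q (subst (y ∣_) xy≡pq (n∣m*n x))))
  (regroup (gcd x p) (gcd x q) (gcd y p) (gcd y q))
  where
  regroup : ∀ g h g′ h′ → g * h * (g′ * h′) ≡ g * g′ * (h * h′)
  regroup = solve-∀

∣gcd*gcd : Coprime p q → x * y ≡ p * q → p ∣ gcd x p * gcd y p
∣gcd*gcd {p} {q} {x} {y} p⊥q xy≡pq =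
  coprime-divisor (p⊥ (gcd[m,n]∣n y q)) (coprime-divisor (p⊥ (gcd[m,n]∣n x q))
    (subst (p ∣_) pq≡ (m∣m*n q)))
  where
  p⊥ : ∀ {h} → h ∣ q → Coprime p h
  p⊥ = coprime-∣-∣ p⊥q ∣-refl
  pq≡ : p * q ≡ gcd x q * (gcd y q * (gcd x p * gcd y p))
  pq≡ = trans (sym xy≡pq) (trans (*≡gcd*gcd {x = x} {y} p⊥q xy≡pq)
          (trans (*-comm (gcd x p * gcd y p) (gcd x q * gcd y q))
                 (*-assoc (gcd x q) (gcd y q) (gcd x p * gcd y p))))

gcd*gcd≡ : ∀ {p q x y} .{{_ : NonZero q}} → Coprime p q → x * y ≡ p * q → gcd x p * gcd y p ≡ p
gcd*gcd≡ {p} {q} {x} {y} p⊥q xy≡pq = sym (∣-antisym-*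
  (∣gcd*gcd {x = x} {y} p⊥q xy≡pq)
  (∣gcd*gcd {x = x} {y} (Coprimality.sym p⊥q) (trans xy≡pq (*-comm p q)))
  (trans (sym (*≡gcd*gcd {x = x} {y} p⊥q xy≡pq)) xy≡pq))

record Split (u v u₁ u₂ v₁ v₂ : ℕ) : Set where
  constructor split
  field
    split-u : u ≡ u₁ * u₂
    split-v : v ≡ v₁ * v₂

record FourNumbers (m₁ m₂ p₁ p₂ : ℕ) : Set where
  field
    rows    : Split m₁ m₂ (gcd m₁ p₁) (gcd m₁ p₂) (gcd m₂ p₁) (gcd m₂ p₂)
    columns : Split p₁ p₂ (gcd m₁ p₁) (gcd m₂ p₁) (gcd m₁ p₂) (gcd m₂ p₂)

open FourNumbers

four-numbers : ∀ {m₁ m₂ p₁ p₂} → m₁ * m₂ ≡ p₁ * p₂ → Coprime m₁ m₂ → Coprime p₁ p₂ →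
  FourNumbers m₁ m₂ p₁ p₂
four-numbers {m₁} {m₂} {p₁} {p₂} m≡p m₁⊥m₂ p₁⊥p₂ = record
  { rows    = split (∣*⇒≡gcd*gcd p₁⊥p₂ (subst (m₁ ∣_) m≡p (m∣m*n m₂)))
                    (∣*⇒≡gcd*gcd p₁⊥p₂ (subst (m₂ ∣_) m≡p (n∣m*n m₁)))
  ; columns = split (trans (∣*⇒≡gcd*gcd m₁⊥m₂ (subst (p₁ ∣_) (sym m≡p) (m∣m*n p₂)))
                           (cong₂ _*_ (gcd-comm p₁ m₁) (gcd-comm p₁ m₂)))
                    (trans (∣*⇒≡gcd*gcd m₁⊥m₂ (subst (p₂ ∣_) (sym m≡p) (n∣m*n p₁)))
                           (cong₂ _*_ (gcd-comm p₂ m₁) (gcd-comm p₂ m₂)))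
  }

module _ {u₁ u₂ v₁ v₂ w₁ w₂ z₁ z₂ : ℕ} where

  split-unit : ∀ {u v w z} → Split u v u₁ u₂ v₁ v₂ → Split w z w₁ w₂ z₁ z₂ →
    u * w ≡ v * z + 1 → u₁ * u₂ * w₁ * w₂ ≡ v₁ * v₂ * z₁ * z₂ + 1
  split-unit (split refl refl) (split refl refl) eq =
    trans (*-assoc (u₁ * u₂) w₁ w₂) (trans eq (cong (_+ 1) (sym (*-assoc (v₁ * v₂) z₁ z₂))))

  split-sum : ∀ {u v w z n} → Split u v u₁ u₂ v₁ v₂ → Split w z w₁ w₂ z₁ z₂ →
    n ≡ u * w + v * z → n ≡ u₁ * u₂ * w₁ * w₂ + v₁ * v₂ * z₁ * z₂
  split-sum (split refl refl) (split refl refl) eq =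
    trans eq (sym (cong₂ _+_ (*-assoc (u₁ * u₂) w₁ w₂) (*-assoc (v₁ * v₂) z₁ z₂)))

split-double : ∀ {x u v u₁ u₂ v₁ v₂} → 2 ∣ x → x / 2 ≡ u * v → Split u v u₁ u₂ v₁ v₂ →
  x ≡ 2 * u₁ * v₁ * u₂ * v₂
split-double {u₁ = u₁} {u₂} {v₁} {v₂} (divides h refl) h≡uv (split refl refl) = begin
  h * 2                       ≡⟨ *-comm h 2 ⟩
  2 * h                       ≡⟨ cong (2 *_) (trans (sym (m*n/n≡m h 2)) h≡uv) ⟩
  2 * (u₁ * u₂ * (v₁ * v₂))   ≡⟨ regroup u₁ u₂ v₁ v₂ ⟩
  2 * u₁ * v₁ * u₂ * v₂       ∎
  where
  open ≡-Reasoning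
  regroup : ∀ u₁ u₂ v₁ v₂ → 2 * (u₁ * u₂ * (v₁ * v₂)) ≡ 2 * u₁ * v₁ * u₂ * v₂
  regroup = solve-∀

odd-root : 2 ∣ x → x * y + 1 ≡ u * u → ∃[ k ] u ≡ 1 + k * 2
odd-root {x} {y} {u} 2∣x xy+1≡uu with u divMod 2
... | result k (suc zero) u≡1+2k = k , u≡1+2k
... | result k zero refl = contradiction (∣1⇒≡1 (∣m+n∣m⇒∣n 2∣xy+1 (∣m⇒∣m*n y 2∣x))) λ ()
  where
  2∣xy+1 : 2 ∣ x * y + 1
  2∣xy+1 = subst (2 ∣_) (sym xy+1≡uu) (∣m⇒∣m*n u (n∣m*n k))

[1+2k+1]/2≡1+k : ∀ k → (1 + k * 2 + 1) / 2 ≡ suc k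
[1+2k+1]/2≡1+k k = trans (cong (_/ 2) (regroup k)) (m*n/n≡m (suc k) 2)
  where
  regroup : ∀ k → 1 + k * 2 + 1 ≡ suc k * 2
  regroup = solve-∀

2X*2Y+1≡[1+2k]²⇒XY≡[k+1]k : ∀ X Y k → X * 2 * (Y * 2) + 1 ≡ (1 + k * 2) * (1 + k * 2) →
  X * Y ≡ suc k * k
2X*2Y+1≡[1+2k]²⇒XY≡[k+1]k X Y k eq =
  *-cancelˡ-≡ (X * Y) (suc k * k) 4 (suc-injective (trans (lhs X Y) (trans eq (rhs k))))
  where
  lhs : ∀ X Y → suc (4 * (X * Y)) ≡ X * 2 * (Y * 2) + 1
  lhs = solve-∀
  rhs : ∀ k → (1 + k * 2) * (1 + k * 2) ≡ suc (4 * (suc k * k))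
  rhs = solve-∀

halves-of-root : {{_ : NonZero x}} {{_ : NonZero y}} → 2 ∣ x → 2 ∣ y → x * y + 1 ≡ u * u →
  let P = (u + 1) / 2
      Q = (u ∸ 1) / 2
  in (x / 2 * (y / 2) ≡ P * Q) × (P ≡ Q + 1) × (u ≡ P + Q) × NonZero P × NonZero Q
halves-of-root {u = u} 2∣x@(divides X refl) (divides Y refl) xy+1≡uu
  with odd-root {y = Y * 2} {u = u} 2∣x xy+1≡uu
... | k , refl =
  trans (cong₂ _*_ (m*n/n≡m X 2) (m*n/n≡m Y 2)) (trans XY≡[k+1]k (sym (cong₂ _*_ P≡1+k Q≡k))) ,
  trans P≡1+k (trans (+-comm 1 k) (cong (_+ 1) (sym Q≡k))) ,
  trans (regroup k) (sym (cong₂ _+_ P≡1+k Q≡k)) ,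
  subst NonZero (sym P≡1+k) _ ,
  subst NonZero (sym Q≡k) k≢0
  where
  P≡1+k : (1 + k * 2 + 1) / 2 ≡ suc k
  P≡1+k = [1+2k+1]/2≡1+k k
  Q≡k : k * 2 / 2 ≡ k
  Q≡k = m*n/n≡m k 2
  regroup : ∀ k → 1 + k * 2 ≡ suc k + k
  regroup = solve-∀
  XY≡[k+1]k : X * Y ≡ suc k * k
  XY≡[k+1]k = 2X*2Y+1≡[1+2k]²⇒XY≡[k+1]k X Y k xy+1≡uu
  k≢0 : NonZero k
  k≢0 = m*n≢0⇒n≢0 (suc k) {{subst NonZero XY≡[k+1]k (m*n≢0 X Y {{m*n≢0⇒m≢0 X}} {{m*n≢0⇒m≢0 Y}})}}

record RootSplitting (x y u : ℕ) : Set where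
  field
    half-x    : x / 2 ≡ xPO x u * xMO x u
    half-y    : y / 2 ≡ xPO y u * xMO y u
    unit      : xPO x u * xPO y u ≡ xMO x u * xMO y u + 1
    root      : u ≡ xPO x u * xPO y u + xMO x u * xMO y u
    coprime-x : Coprime (xPO x u) (xMO x u)
    coprime-y : Coprime (xPO y u) (xMO y u)

open RootSplitting

root-splitting : {{_ : NonZero x}} {{_ : NonZero y}} → 2 ∣ x → 2 ∣ y → x * y + 1 ≡ u * u →
  RootSplitting x y u
root-splitting {x} {y} {u} 2∣x 2∣y xy+1≡uu with halves-of-root 2∣x 2∣y xy+1≡uu
... | XY≡PQ , P≡Q+1 , u≡P+Q , P≢0 , Q≢0 = record
  { half-x    = ∣*⇒≡gcd*gcd P⊥Q (subst (x / 2 ∣_) XY≡PQ (m∣m*n (y / 2)))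
  ; half-y    = ∣*⇒≡gcd*gcd P⊥Q (subst (y / 2 ∣_) XY≡PQ (n∣m*n (x / 2)))
  ; unit      = trans P-part (trans P≡Q+1 (cong (_+ 1) (sym Q-part)))
  ; root      = trans u≡P+Q (sym (cong₂ _+_ P-part Q-part))
  ; coprime-x = coprime-∣-∣ P⊥Q (gcd[m,n]∣n (x / 2) P) (gcd[m,n]∣n (x / 2) Q)
  ; coprime-y = coprime-∣-∣ P⊥Q (gcd[m,n]∣n (y / 2) P) (gcd[m,n]∣n (y / 2) Q)
  }
  where
  P Q : ℕ
  P = (u + 1) / 2
  Q = (u ∸ 1) / 2
  P⊥Q : Coprime P Q
  P⊥Q = subst (λ n → Coprime n Q) (sym P≡Q+1) (coprime-+1 Q)
  P-part : gcd (x / 2) P * gcd (y / 2) P ≡ P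
  P-part = gcd*gcd≡ {x = x / 2} {y / 2} {{Q≢0}} P⊥Q XY≡PQ
  Q-part : gcd (x / 2) Q * gcd (y / 2) Q ≡ Q
  Q-part = gcd*gcd≡ {x = x / 2} {y / 2} {{P≢0}} (Coprimality.sym P⊥Q) (trans XY≡PQ (*-comm P Q))

consecutive-squares : p ≡ q + 1 → p * p + q * q ≡ 1 + 2 * p * q
consecutive-squares {q = q} refl = identity q
  where
  identity : ∀ q → (q + 1) * (q + 1) + q * q ≡ 1 + 2 * (q + 1) * q
  identity = solve-∀

-- x − y = (p − p′)(q − q′), with both sides moved so that no subtraction occurs.
consecutive-cross : ∀ {p p′ q q′} → p ≡ p′ + 1 → q ≡ q′ + 1 →
  x + (p * q′ + p′ * q) ≡ y + (p * q + p′ * q′) → x ≡ y + 1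
consecutive-cross {x} {y} {p′ = p′} {q′ = q′} refl refl eq =
  +-cancelʳ-≡ _ x (y + 1) (trans eq (identity y p′ q′))
  where
  identity : ∀ y p′ q′ →
    y + ((p′ + 1) * (q′ + 1) + p′ * q′) ≡ y + 1 + ((p′ + 1) * q′ + p′ * (q′ + 1))
  identity = solve-∀

-- a⁺⁺ a⁻⁺ a⁺⁻ a⁻⁻ stand for a₊₊ a₋₊ a₊₋ a₋₋, and R± = a_{±O} b_{±O}, S± = a_{O±} c_{±O},
-- T± = b_{O±} c_{O±}, so that r = R⁺ + R⁻ and (ii) reads R⁺ = R⁻ + 1 etc.
module AHSExtension (a⁺⁺ a⁻⁺ a⁺⁻ a⁻⁻ b⁺⁺ b⁻⁺ b⁺⁻ b⁻⁻ c⁺⁺ c⁻⁺ c⁺⁻ c⁻⁻ : ℕ) where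

  half-a half-b half-c R⁺ R⁻ S⁺ S⁻ T⁺ T⁻ d₁ d₂ d₃ d₄ : ℕ
  half-a = a⁺⁺ * a⁻⁺ * a⁺⁻ * a⁻⁻
  half-b = b⁺⁺ * b⁻⁺ * b⁺⁻ * b⁻⁻
  half-c = c⁺⁺ * c⁻⁺ * c⁺⁻ * c⁻⁻
  R⁺ = a⁺⁺ * a⁺⁻ * b⁺⁺ * b⁺⁻
  R⁻ = a⁻⁺ * a⁻⁻ * b⁻⁺ * b⁻⁻
  S⁺ = a⁺⁺ * a⁻⁺ * c⁺⁺ * c⁺⁻
  S⁻ = a⁺⁻ * a⁻⁻ * c⁻⁺ * c⁻⁻
  T⁺ = b⁺⁺ * b⁻⁺ * c⁺⁺ * c⁻⁺
  T⁻ = b⁺⁻ * b⁻⁻ * c⁺⁻ * c⁻⁻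
  d₁ = a⁻⁺ * b⁻⁻ * c⁺⁻ + a⁺⁻ * b⁺⁺ * c⁻⁺
  d₂ = a⁻⁻ * b⁻⁺ * c⁻⁺ + a⁺⁺ * b⁺⁻ * c⁺⁻
  d₃ = a⁺⁺ * b⁺⁺ * c⁺⁺ + a⁻⁻ * b⁻⁻ * c⁻⁻
  d₄ = a⁺⁻ * b⁺⁻ * c⁻⁻ + a⁻⁺ * b⁻⁺ * c⁺⁺
  -- Inlined so that the ring solver sees the monomials behind these abbreviations.
  {-# INLINE half-a #-}
  {-# INLINE half-b #-}
  {-# INLINE half-c #-}
  {-# INLINE R⁺ #-}
  {-# INLINE R⁻ #-}
  {-# INLINE S⁺ #-}
  {-# INLINE S⁻ #-}
  {-# INLINE T⁺ #-}
  {-# INLINE T⁻ #-}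
  {-# INLINE d₁ #-}
  {-# INLINE d₂ #-}
  {-# INLINE d₃ #-}
  {-# INLINE d₄ #-}

  private
    gcds : List ℕ
    gcds = a⁺⁺ ∷ a⁻⁺ ∷ a⁺⁻ ∷ a⁻⁻ ∷ b⁺⁺ ∷ b⁻⁺ ∷ b⁺⁻ ∷ b⁻⁻ ∷ c⁺⁺ ∷ c⁻⁺ ∷ c⁺⁻ ∷ c⁻⁻ ∷ []
    {-# INLINE gcds #-}

  d-factorisation : ∀ {a b c r s t} →
    a ≡ 2 * a⁺⁺ * a⁻⁺ * a⁺⁻ * a⁻⁻ → b ≡ 2 * b⁺⁺ * b⁻⁺ * b⁺⁻ * b⁻⁻ → c ≡ 2 * c⁺⁺ * c⁻⁺ * c⁺⁻ * c⁻⁻ →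
    r ≡ R⁺ + R⁻ → s ≡ S⁺ + S⁻ → t ≡ T⁺ + T⁻ →
    R⁺ ≡ R⁻ + 1 → S⁺ ≡ S⁻ + 1 → T⁺ ≡ T⁻ + 1 →
    a + b + c + 2 * a * b * c + 2 * r * s * t ≡ 2 * d₁ * d₂ * d₃ * d₄
  d-factorisation refl refl refl refl refl refl R-unit S-unit T-unit =
    +-cancelʳ-≡ _ _ _ (trans identity (cong (λ e → 2 * d₁ * d₂ * d₃ * d₄ + e * 2)
      (cong₂ _+_ (cong₂ _+_ (cong (half-c *_) (sym (consecutive-squares R-unit)))
                            (cong (half-b *_) (sym (consecutive-squares S-unit))))
                 (cong (half-a *_) (sym (consecutive-squares T-unit))))))
    where
    -- The two sides of (iii) differ by c (1 − (R⁺ − R⁻)²) + b (1 − (S⁺ − S⁻)²) + a (1 − (T⁺ − T⁻)²).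
    identity :
      let a = 2 * a⁺⁺ * a⁻⁺ * a⁺⁻ * a⁻⁻
          b = 2 * b⁺⁺ * b⁻⁺ * b⁺⁻ * b⁻⁻
          c = 2 * c⁺⁺ * c⁻⁺ * c⁺⁻ * c⁻⁻
          r = R⁺ + R⁻
          s = S⁺ + S⁻
          t = T⁺ + T⁻
      in a + b + c + 2 * a * b * c + 2 * r * s * t
           + (half-c * (R⁺ * R⁺ + R⁻ * R⁻) + half-b * (S⁺ * S⁺ + S⁻ * S⁻) + half-a * (T⁺ * T⁺ + T⁻ * T⁻)) * 2
         ≡ 2 * d₁ * d₂ * d₃ * d₄
           + (half-c * (1 + 2 * R⁺ * R⁻) + half-b * (1 + 2 * S⁺ * S⁻) + half-a * (1 + 2 * T⁺ * T⁻)) * 2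
    identity = solve gcds

  c-d-unit : S⁺ ≡ S⁻ + 1 → T⁺ ≡ T⁻ + 1 → c⁻⁺ * c⁺⁻ * d₃ * d₄ ≡ c⁻⁻ * c⁺⁺ * d₁ * d₂ + 1
  c-d-unit S-unit T-unit = consecutive-cross T-unit S-unit identity
    where
    identity : c⁻⁺ * c⁺⁻ * d₃ * d₄ + (T⁺ * S⁻ + T⁻ * S⁺) ≡ c⁻⁻ * c⁺⁺ * d₁ * d₂ + (T⁺ * S⁺ + T⁻ * S⁻)
    identity = solve gcds

  a-d-unit : R⁺ ≡ R⁻ + 1 → S⁺ ≡ S⁻ + 1 → a⁺⁻ * a⁻⁺ * d₂ * d₃ ≡ a⁺⁺ * a⁻⁻ * d₁ * d₄ + 1
  a-d-unit R-unit S-unit = consecutive-cross R-unit S-unit identity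
    where
    identity : a⁺⁻ * a⁻⁺ * d₂ * d₃ + (R⁺ * S⁻ + R⁻ * S⁺) ≡ a⁺⁺ * a⁻⁻ * d₁ * d₄ + (R⁺ * S⁺ + R⁻ * S⁻)
    identity = solve gcds

  b-d-unit : R⁺ ≡ R⁻ + 1 → T⁺ ≡ T⁻ + 1 → b⁻⁺ * b⁺⁻ * d₁ * d₃ ≡ b⁻⁻ * b⁺⁺ * d₂ * d₄ + 1
  b-d-unit R-unit T-unit = consecutive-cross R-unit T-unit identity
    where
    identity : b⁻⁺ * b⁺⁻ * d₁ * d₃ + (R⁺ * T⁻ + R⁻ * T⁺) ≡ b⁻⁻ * b⁺⁺ * d₂ * d₄ + (R⁺ * T⁺ + R⁻ * T⁻)
    identity = solve gcds

module TripleGcds (a b c r s t : ℕ) where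

  open AHSExtension (xPP a r s) (xMP a r s) (xPM a r s) (xMM a r s)
                    (xPP b r t) (xMP b r t) (xPM b r t) (xMM b r t)
                    (xPP c s t) (xMP c s t) (xPM c s t) (xMM c s t) public

  record GcdRelations : Set where
    field
      a≡ : a ≡ 2 * xPP a r s * xMP a r s * xPM a r s * xMM a r s
      b≡ : b ≡ 2 * xPP b r t * xMP b r t * xPM b r t * xMM b r t
      c≡ : c ≡ 2 * xPP c s t * xMP c s t * xPM c s t * xMM c s t
      r≡ : r ≡ R⁺ + R⁻
      s≡ : s ≡ S⁺ + S⁻
      t≡ : t ≡ T⁺ + T⁻
      R-unit : R⁺ ≡ R⁻ + 1
      S-unit : S⁺ ≡ S⁻ + 1
      T-unit : T⁺ ≡ T⁻ + 1

  gcd-relations : {{_ : NonZero a}} {{_ : NonZero b}} {{_ : NonZero c}} → 2 ∣ a → 2 ∣ b → 2 ∣ c →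
    a * b + 1 ≡ r * r → a * c + 1 ≡ s * s → b * c + 1 ≡ t * t → GcdRelations
  gcd-relations 2∣a 2∣b 2∣c ab+1≡rr ac+1≡ss bc+1≡tt = record
    { a≡ = split-double 2∣a (half-x R) (rows A)
    ; b≡ = split-double 2∣b (half-y R) (rows B)
    ; c≡ = split-double 2∣c (half-y S) (rows C)
    ; r≡ = split-sum (rows A) (rows B) (root R)
    ; s≡ = split-sum (columns A) (rows C) (root S)
    ; t≡ = split-sum (columns B) (columns C) (root T)
    ; R-unit = split-unit (rows A) (rows B) (unit R)
    ; S-unit = split-unit (columns A) (rows C) (unit S)
    ; T-unit = split-unit (columns B) (columns C) (unit T)
    }
    where
    R : RootSplitting a b r
    R = root-splitting 2∣a 2∣b ab+1≡rr
    S : RootSplitting a c s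
    S = root-splitting 2∣a 2∣c ac+1≡ss
    T : RootSplitting b c t
    T = root-splitting 2∣b 2∣c bc+1≡tt
    A : FourNumbers (xPO a r) (xMO a r) (xPO a s) (xMO a s)
    A = four-numbers (trans (sym (half-x R)) (half-x S)) (coprime-x R) (coprime-x S)
    B : FourNumbers (xPO b r) (xMO b r) (xPO b t) (xMO b t)
    B = four-numbers (trans (sym (half-y R)) (half-x T)) (coprime-y R) (coprime-x T)
    C : FourNumbers (xPO c s) (xMO c s) (xPO c t) (xMO c t)
    C = four-numbers (trans (sym (half-y S)) (half-y T)) (coprime-y S) (coprime-y T)

mainTheorem5 : (a b c r s t : ℕ) →
    NonZero a → NonZero b → NonZero c →
    NonZero r → NonZero s → NonZero t →
    2 ∣ a → 2 ∣ b → 2 ∣ c →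
    ¬ (a ≡ b) → ¬ (a ≡ c) → ¬ (b ≡ c) →
    a * b + 1 ≡ r * r → a * c + 1 ≡ s * s → b * c + 1 ≡ t * t →
    ¬ (irregQ a b c ≡ + 0) →
    let app = xPP a r s
        amp = xMP a r s
        apm = xPM a r s
        amm = xMM a r s
        bpp = xPP b r t
        bmp = xMP b r t
        bpm = xPM b r t
        bmm = xMM b r t
        cpp = xPP c s t
        cmp = xMP c s t
        cpm = xPM c s t
        cmm = xMM c s t
        d = a + b + c + 2 * a * b * c + 2 * r * s * t
        d₁ = amp * bmm * cpm + apm * bpp * cmp
        d₂ = amm * bmp * cmp + app * bpm * cpm
        d₃ = app * bpp * cpp + amm * bmm * cmm
        d₄ = apm * bpm * cmm + amp * bmp * cpp
    in
    -- (i)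
    (a ≡ 2 * app * amp * apm * amm) ×
    (b ≡ 2 * bpp * bmp * bpm * bmm) ×
    (c ≡ 2 * cpp * cmp * cpm * cmm) ×
    -- (ii)
    (app * apm * bpp * bpm ≡ amp * amm * bmp * bmm + 1) ×
    (app * amp * cpp * cpm ≡ apm * amm * cmp * cmm + 1) ×
    (bpp * bmp * cpp * cmp ≡ bpm * bmm * cpm * cmm + 1) ×
    -- (iii)
    (d ≡ 2 * d₁ * d₂ * d₃ * d₄) ×
    -- (iv)
    (cmp * cpm * d₃ * d₄ ≡ cmm * cpp * d₁ * d₂ + 1) ×
    (apm * amp * d₂ * d₃ ≡ app * amm * d₁ * d₄ + 1) ×
    (bmp * bpm * d₁ * d₃ ≡ bmm * bpp * d₂ * d₄ + 1)
mainTheorem5 a b c r s t a≢0 b≢0 c≢0 _ _ _ 2∣a 2∣b 2∣c _ _ _ ab+1≡rr ac+1≡ss bc+1≡tt _ =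
  a≡ , b≡ , c≡ , R-unit , S-unit , T-unit ,
  d-factorisation a≡ b≡ c≡ r≡ s≡ t≡ R-unit S-unit T-unit ,
  c-d-unit S-unit T-unit , a-d-unit R-unit S-unit , b-d-unit R-unit T-unit
  where
  open TripleGcds a b c r s t
  open GcdRelations (gcd-relations {{a≢0}} {{b≢0}} {{c≢0}} 2∣a 2∣b 2∣c ab+1≡rr ac+1≡ss bc+1≡tt)
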